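{- Let $\pi,\sigma$ be rankings of a set $U$ with $|U|=n$, and let $\omega$ be the subranking of $\pi$ with rank interval $[j:k]$, $1\le j\le k\le n$. Then $$\mathcal{LR}(\omega,\sigma)=\sum_{i=j}^{k-1} d_i(\pi,\sigma),$$ where for $1\le i\le n-1$, $d_i(\pi,\sigma)=\#\{e\in U:\ \pi(e)\le i,\ \sigma(e)\ge i+1\}+\#\{e\in U:\ \pi(e)\ge i+1,\ \sigma(e)\le i\}$.
   Context: A ranking of a finite set $U$ with $|U|=n$ is a bijection $\pi:U\to\{1,\dots,n\}$. For a ranking $\sigma$, an integer interval $I$ and $e\in U$, let $p(e)^I_\sigma=1$ if $\sigma(e)\in I$ and $0$ otherwise. For $1\le a\le b\le n$, the subranking of $\pi$ with rank interval $[a:b]$ consists of the elements $e$ with $\pi(e)\in[a:b]$ in the order of $\pi$. LR-distance (extensions taken with respect to $\pi$): for a subranking $\tau$ of $\pi$ with rank interval $[a:b]$, define $\mathcal{LR}(\tau,\sigma)=0$ if $a\ge b$, and otherwise, with $h=\lfloor (a+b)/2\rfloor$ and $\tau_\ell,\tau_r$ the subrankings of $\pi$ with rank intervals $[a:h]$ and $[h+1:b]$, $$\mathcal{LR}(\tau,\sigma)=\sum_{e:\ \pi(e)\in[1:h]} p(e)^{[h+1:n]}_\sigma+\mathcal{LR}(\tau_\ell,\sigma)+\sum_{e:\ \pi(e)\in[h+1:n]} p(e)^{[1:h]}_\sigma+\mathcal{LR}(\tau_r,\sigma).$$ -}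

module Defs where

open import Data.Nat using (ℕ; zero; suc; _+_; _∸_; _≤?_; ⌊_/2⌋)
open import Data.Fin using (Fin; toℕ)
open import Data.Fin.Permutation using (Permutation′; _⟨$⟩ʳ_)
open import Data.List using (List; map; allFin)
open import Data.Nat.ListAction using (sum)
open import Data.Bool using (Bool; true; false; _∧_; if_then_else_)
open import Relation.Nullary.Decidable using (⌊_⌋)

-- A ranking of U = Fin n is a bijection U → {1..n}; we represent it by a
-- permutation of Fin n, the rank of e being 1 + toℕ (π e).
Ranking : ℕ → Set
Ranking n = Permutation′ n

rank : ∀ {n} → Ranking n → Fin n → ℕ
rank π e = suc (toℕ (π ⟨$⟩ʳ e))

inI : ℕ → ℕ → ℕ → Bool
inI a b x = ⌊ a ≤? x ⌋ ∧ ⌊ x ≤? b ⌋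

count : ∀ {n} → (Fin n → Bool) → ℕ
count {n} P = sum (map (λ e → if P e then 1 else 0) (allFin n))

crossSum : ∀ {n} → Ranking n → Ranking n → ℕ → ℕ → ℕ → ℕ → ℕ
crossSum π σ c d c' d' = count (λ e → inI c d (rank π e) ∧ inI c' d' (rank σ e))

-- LR-distance of the subranking of π with rank interval [a:b], with a fuel
-- argument ensuring termination (fuel ≥ b ∸ a suffices; we start with b ∸ a).
LRfuel : ∀ {n} → ℕ → Ranking n → Ranking n → ℕ → ℕ → ℕ
LRfuel zero π σ a b = 0
LRfuel {n} (suc f) π σ a b with ⌊ b ≤? a ⌋
... | true = 0
... | false =
  let h = ⌊ (a + b) /2⌋ in
  crossSum π σ 1 h (suc h) n + LRfuel f π σ a h
  + crossSum π σ (suc h) n 1 h + LRfuel f π σ (suc h) b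

LR : ∀ {n} → Ranking n → Ranking n → ℕ → ℕ → ℕ
LR π σ a b = LRfuel (b ∸ a) π σ a b

d : ∀ {n} → Ranking n → Ranking n → ℕ → ℕ
d π σ i = count (λ e → ⌊ rank π e ≤? i ⌋ ∧ ⌊ suc i ≤? rank σ e ⌋)
        + count (λ e → ⌊ suc i ≤? rank π e ⌋ ∧ ⌊ rank σ e ≤? i ⌋)

sumFrom : ℕ → ℕ → (ℕ → ℕ) → ℕ
sumFrom j zero f = 0
sumFrom j (suc m) f = f j + sumFrom (suc j) m f

-- Σ_{i=j}^{k-1} f i  (empty when k ≤ j)
sumRange : ℕ → ℕ → (ℕ → ℕ) → ℕ
sumRange j k f = sumFrom j (k ∸ j) f

{-# OPTIONS --safe #-}
module Submission where

-- The recursion defining LR cuts the interval [a:b] at its midpoint h and adds the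
-- elements crossing the cut between h and h+1 in either direction, which is exactly
-- d_h.  Recursing on both halves, every cut point a ≤ h < b is visited exactly once,
-- so LR of [a:b] telescopes to Σ_{h=a}^{b-1} d_h, whatever the choice of midpoints.

open import Defs
open import Data.Nat using (ℕ; suc; _+_; _∸_; _≤_; _<_; _≤?_; ⌊_/2⌋; s≤s; s≤s⁻¹)
open import Data.Nat.Properties
open import Data.Nat.Tactic.RingSolver using (solve-∀)
open import Data.Fin using (Fin)
open import Data.Fin.Properties using (toℕ<n)
open import Data.Fin.Permutation using (_⟨$⟩ʳ_)
open import Data.List using (allFin)
open import Data.List.Properties using (map-cong)
open import Data.Nat.ListAction using (sum)
open import Data.Bool using (Bool; true; _∧_; if_then_else_)
open import Data.Bool.Properties using (∧-identityʳ)
open import Relation.Nullary.Decidable using (⌊_⌋; isYes≗does; dec-true; yes; no)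
open import Relation.Binary.PropositionalEquality
  using (_≡_; refl; sym; trans; cong; cong₂; module ≡-Reasoning)

count-cong : ∀ {n} {P Q : Fin n → Bool} → (∀ e → P e ≡ Q e) → count P ≡ count Q
count-cong {n} P≗Q = cong sum (map-cong (λ e → cong (if_then 1 else 0) (P≗Q e)) (allFin n))

rank≤n : ∀ {n} (π : Ranking n) e → rank π e ≤ n
rank≤n π e = toℕ<n (π ⟨$⟩ʳ e)

⌊rank≤?n⌋≡true : ∀ {n} (π : Ranking n) e → ⌊ rank π e ≤? n ⌋ ≡ true
⌊rank≤?n⌋≡true {n} π e = trans (isYes≗does (rank π e ≤? n)) (dec-true (rank π e ≤? n) (rank≤n π e))

crossSums≡d : ∀ {n} (π σ : Ranking n) h →
  crossSum π σ 1 h (suc h) n + crossSum π σ (suc h) n 1 h ≡ d π σ h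
crossSums≡d {n} π σ h = cong₂ _+_
  (count-cong λ e → cong (⌊ rank π e ≤? h ⌋ ∧_) (upper-bound-vacuous σ e))
  (count-cong λ e → cong (_∧ ⌊ rank σ e ≤? h ⌋) (upper-bound-vacuous π e))
  where
  upper-bound-vacuous : (τ : Ranking n) (e : Fin n) →
    ⌊ suc h ≤? rank τ e ⌋ ∧ ⌊ rank τ e ≤? n ⌋ ≡ ⌊ suc h ≤? rank τ e ⌋
  upper-bound-vacuous τ e = trans (cong (⌊ suc h ≤? rank τ e ⌋ ∧_) (⌊rank≤?n⌋≡true τ e))
                                  (∧-identityʳ ⌊ suc h ≤? rank τ e ⌋)

[n∸m]+[o∸n]≡o∸m : ∀ {m n o} → m ≤ n → n ≤ o → (n ∸ m) + (o ∸ n) ≡ o ∸ m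
[n∸m]+[o∸n]≡o∸m {m} {n} {o} m≤n n≤o = begin
  (n ∸ m) + (o ∸ n)   ≡⟨ +-comm (n ∸ m) (o ∸ n) ⟩
  (o ∸ n) + (n ∸ m)   ≡⟨ sym (+-∸-assoc (o ∸ n) m≤n) ⟩
  ((o ∸ n) + n) ∸ m   ≡⟨ cong (_∸ m) (m∸n+n≡m n≤o) ⟩
  o ∸ m               ∎
  where open ≡-Reasoning

⌊1+n+n/2⌋≡n : ∀ n → ⌊ suc (n + n) /2⌋ ≡ n
⌊1+n+n/2⌋≡n 0       = refl
⌊1+n+n/2⌋≡n (suc n) = cong suc (trans (cong ⌊_/2⌋ (+-suc n n)) (⌊1+n+n/2⌋≡n n))

≤-midpoint : ∀ {a b} → a ≤ b → a ≤ ⌊ a + b /2⌋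
≤-midpoint {a} a≤b = ≤-trans (≤-reflexive (n≡⌊n+n/2⌋ a)) (⌊n/2⌋-mono (+-monoʳ-≤ a a≤b))

midpoint-< : ∀ {a b} → a < b → ⌊ a + b /2⌋ < b
midpoint-< {a} {suc c} (s≤s a≤c) = s≤s (begin
  ⌊ a + suc c /2⌋      ≤⟨ ⌊n/2⌋-mono (+-monoˡ-≤ (suc c) a≤c) ⟩
  ⌊ c + suc c /2⌋      ≡⟨ cong ⌊_/2⌋ (+-suc c c) ⟩
  ⌊ suc (c + c) /2⌋    ≡⟨ ⌊1+n+n/2⌋≡n c ⟩
  c                    ∎)
  where open ≤-Reasoning

module _ (f : ℕ → ℕ) where

  sumFrom-+ : ∀ a x y → sumFrom a (x + y) f ≡ sumFrom a x f + sumFrom (a + x) y f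
  sumFrom-+ a 0       y = cong (λ c → sumFrom c y f) (sym (+-identityʳ a))
  sumFrom-+ a (suc x) y = begin
    f a + sumFrom (suc a) (x + y) f
      ≡⟨ cong (f a +_) (sumFrom-+ (suc a) x y) ⟩
    f a + (sumFrom (suc a) x f + sumFrom (suc a + x) y f)
      ≡⟨ sym (+-assoc (f a) _ _) ⟩
    f a + sumFrom (suc a) x f + sumFrom (suc a + x) y f
      ≡⟨ cong (λ c → f a + sumFrom (suc a) x f + sumFrom c y f) (sym (+-suc a x)) ⟩
    f a + sumFrom (suc a) x f + sumFrom (a + suc x) y f
      ∎
    where open ≡-Reasoning

  sumRange-empty : ∀ {a b} → b ≤ a → sumRange a b f ≡ 0
  sumRange-empty {a} b≤a = cong (λ m → sumFrom a m f) (m≤n⇒m∸n≡0 b≤a)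

  sumRange-head : ∀ {a b} → a < b → sumRange a b f ≡ f a + sumRange (suc a) b f
  sumRange-head {a} a<b = cong (λ m → sumFrom a m f) (+-∸-assoc 1 a<b)

  sumRange-split : ∀ {a h b} → a ≤ h → h ≤ b → sumRange a b f ≡ sumRange a h f + sumRange h b f
  sumRange-split {a} {h} {b} a≤h h≤b = begin
    sumFrom a (b ∸ a) f
      ≡⟨ cong (λ m → sumFrom a m f) (sym ([n∸m]+[o∸n]≡o∸m a≤h h≤b)) ⟩
    sumFrom a ((h ∸ a) + (b ∸ h)) f
      ≡⟨ sumFrom-+ a (h ∸ a) (b ∸ h) ⟩
    sumFrom a (h ∸ a) f + sumFrom (a + (h ∸ a)) (b ∸ h) f
      ≡⟨ cong (λ c → sumFrom a (h ∸ a) f + sumFrom c (b ∸ h) f) (m+[n∸m]≡n a≤h) ⟩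
    sumFrom a (h ∸ a) f + sumFrom h (b ∸ h) f
      ∎
    where open ≡-Reasoning

module _ {n} (π σ : Ranking n) where

  LRfuel≡sumRange-d : ∀ fuel a b → b ∸ a ≤ fuel → LRfuel fuel π σ a b ≡ sumRange a b (d π σ)
  LRfuel≡sumRange-d 0 a b b∸a≤0 = sym (sumRange-empty (d π σ) (m∸n≡0⇒m≤n {b} {a} (n≤0⇒n≡0 b∸a≤0)))
  LRfuel≡sumRange-d (suc fuel) a b b∸a≤1+fuel with b ≤? a
  ... | yes b≤a = sym (sumRange-empty (d π σ) b≤a)
  ... | no b≰a = begin
    cross₁ + left + cross₂ + right        ≡⟨ regroup cross₁ left cross₂ right ⟩
    left + ((cross₁ + cross₂) + right)
      ≡⟨ cong₂ _+_ (LRfuel≡sumRange-d fuel a h (within-fuel left-shorter))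
                   (cong₂ _+_ (crossSums≡d π σ h)
                              (LRfuel≡sumRange-d fuel (suc h) b (within-fuel right-shorter))) ⟩
    sumRange a h D + (D h + sumRange (suc h) b D)
      ≡⟨ cong (sumRange a h D +_) (sym (sumRange-head D h<b)) ⟩
    sumRange a h D + sumRange h b D
      ≡⟨ sym (sumRange-split D a≤h (<⇒≤ h<b)) ⟩
    sumRange a b D
      ∎
    where
    open ≡-Reasoning
    D : ℕ → ℕ
    D = d π σ
    h cross₁ cross₂ left right : ℕ
    h = ⌊ a + b /2⌋
    cross₁ = crossSum π σ 1 h (suc h) n
    cross₂ = crossSum π σ (suc h) n 1 h
    left = LRfuel fuel π σ a h
    right = LRfuel fuel π σ (suc h) b

    a<b : a < b
    a<b = ≰⇒> b≰a
    a≤h : a ≤ h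
    a≤h = ≤-midpoint (<⇒≤ a<b)
    h<b : h < b
    h<b = midpoint-< a<b

    regroup : ∀ x l y r → x + l + y + r ≡ l + ((x + y) + r)
    regroup = solve-∀

    within-fuel : ∀ {m} → m < b ∸ a → m ≤ fuel
    within-fuel m<b∸a = s≤s⁻¹ (<-≤-trans m<b∸a b∸a≤1+fuel)

    left-shorter : h ∸ a < b ∸ a
    left-shorter = ∸-monoˡ-< h<b a≤h

    right-shorter : b ∸ suc h < b ∸ a
    right-shorter = ∸-monoʳ-< (s≤s a≤h) h<b

lemma1 : (n : ℕ) (π σ : Ranking n) (j k : ℕ) → 1 ≤ j → j ≤ k → k ≤ n →
    LR π σ j k ≡ sumRange j k (d π σ)
lemma1 n π σ j k _ _ _ = LRfuel≡sumRange-d π σ (k ∸ j) j k ≤-refl
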